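{- For every term $q$, if $q=_{\mathrm{CLC}} F$ then $q\to^*_{\mathrm{CLC}} F$.
   Context: Terms are built from variables and the constants $C,T,F,K,S$ by binary application, left-associated; rules apply in any context. $\mathrm{CLC}$ is the conditional system with rules $C\,T\,x\,y\to x$; $C\,F\,x\,y\to y$; $C\,z\,x\,y\to x \Leftarrow x=y$; $K\,x\,y\to x$; $S\,x\,y\,z\to x\,z\,(y\,z)$, where $=$ is convertibility in $\mathrm{CLC}$ itself, defined by levels: $\mathrm{CLC}_{(0)}$ interprets $=$ as the empty relation, $\mathrm{CLC}_{(n+1)}$ interprets $=$ as convertibility of $\mathrm{CLC}_{(n)}$, and $\to_{\mathrm{CLC}}=\bigcup_n\to_{\mathrm{CLC}_{(n)}}$. $=_{\mathrm{CLC}}$ is convertibility and $\to^*_{\mathrm{CLC}}$ the reflexive–transitive closure of $\to_{\mathrm{CLC}}$. -}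

module Defs where

open import Data.Nat using (ℕ; zero; suc)
open import Data.Product using (∃)
open import Relation.Binary.Construct.Closure.Equivalence using (EqClosure)
open import Relation.Binary.Construct.Closure.ReflexiveTransitive using (Star)

infixl 9 _·_

data Term : Set where
  var : ℕ → Term
  C T F K S : Term
  _·_ : Term → Term → Term

mutual
  -- At level 0 the conditional rule C z x y → x ⇐ x = y never fires
  -- (= is empty); at level n+1 its premise is convertibility of CLC_(n).
  data Step : ℕ → Term → Term → Set where
    CT   : ∀ {n x y} → Step n (C · T · x · y) x
    CF   : ∀ {n x y} → Step n (C · F · x · y) y
    Cz   : ∀ {n z x y} → Conv n x y → Step (suc n) (C · z · x · y) x
    Kr   : ∀ {n x y} → Step n (K · x · y) x
    Sr   : ∀ {n x y z} → Step n (S · x · y · z) (x · z · (y · z))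
    appL : ∀ {n a a′ b} → Step n a a′ → Step n (a · b) (a′ · b)
    appR : ∀ {n a b b′} → Step n b b′ → Step n (a · b) (a · b′)

  Conv : ℕ → Term → Term → Set
  Conv n = EqClosure (Step n)

_⟶_ : Term → Term → Set
a ⟶ b = ∃ λ n → Step n a b

_⟶*_ : Term → Term → Set
_⟶*_ = Star _⟶_

_≃_ : Term → Term → Set
_≃_ = EqClosure _⟶_

module Submission where

-- Let  t ◂ rs ⇓ g  say that the term t applied to the argument list rs evaluates
-- by head reduction to the Boolean constant g, where a conditional C a b c may
-- commit to b as soon as b and c are convertible.  Such a derivation yields an
-- actual reduction sequence to T or F (soundness).  The predicate is preserved
-- by parallel reduction of CLC_(m) in both directions, provided it is already
-- closed under convertibility of CLC_(k) for k < m; by induction on the level it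
-- is therefore closed under =_CLC.  Since F ◂ [] ⇓ false holds trivially, every
-- q =_CLC F evaluates to F, hence reduces to F.

open import Defs
open import Data.Bool using (Bool; true; false)
open import Data.List using (List; []; _∷_)
open import Data.List.Relation.Binary.Pointwise using (Pointwise; []; _∷_)
import Data.List.Relation.Binary.Pointwise.Properties as Pointwise
open import Data.Nat using (ℕ; zero; suc; _⊔_; _≤_; s≤s)
open import Data.Nat.Properties using (m≤m⊔n; m≤n⊔m)
open import Data.Product using (∃; _,_)
open import Relation.Binary.Construct.Closure.Equivalence as Eq using (symmetric)
open import Relation.Binary.Construct.Closure.ReflexiveTransitive as Star
  using (ε; _◅_; _◅◅_)
open import Relation.Binary.Construct.Closure.Symmetric using (fwd; bwd)

mutual
  Step-mono : ∀ {n m a b} → n ≤ m → Step n a b → Step m a b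
  Step-mono n≤m       CT       = CT
  Step-mono n≤m       CF       = CF
  Step-mono (s≤s n≤m) (Cz x≈y) = Cz (Conv-mono n≤m x≈y)
  Step-mono n≤m       Kr       = Kr
  Step-mono n≤m       Sr       = Sr
  Step-mono n≤m       (appL s) = appL (Step-mono n≤m s)
  Step-mono n≤m       (appR s) = appR (Step-mono n≤m s)

  Conv-mono : ∀ {n m a b} → n ≤ m → Conv n a b → Conv m a b
  Conv-mono n≤m ε            = ε
  Conv-mono n≤m (fwd s ◅ ss) = fwd (Step-mono n≤m s) ◅ Conv-mono n≤m ss
  Conv-mono n≤m (bwd s ◅ ss) = bwd (Step-mono n≤m s) ◅ Conv-mono n≤m ss

Conv⇒≃ : ∀ {k a b} → Conv k a b → a ≃ b
Conv⇒≃ {k} = Eq.map (k ,_)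

≃⇒Conv : ∀ {a b} → a ≃ b → ∃ λ N → Conv N a b
≃⇒Conv ε = zero , ε
≃⇒Conv (fwd (n , s) ◅ ss) with ≃⇒Conv ss
... | N , c = n ⊔ N , fwd (Step-mono (m≤m⊔n n N) s) ◅ Conv-mono (m≤n⊔m n N) c
≃⇒Conv (bwd (n , s) ◅ ss) with ≃⇒Conv ss
... | N , c = n ⊔ N , bwd (Step-mono (m≤m⊔n n N) s) ◅ Conv-mono (m≤n⊔m n N) c

⟶*⇒≃ : ∀ {a b} → a ⟶* b → a ≃ b
⟶*⇒≃ = Star.map fwd

≃-transport : ∀ {b b′ c c′} → b ≃ b′ → c ≃ c′ → b ≃ c → b′ ≃ c′
≃-transport b≃b′ c≃c′ b≃c = symmetric _ b≃b′ ◅◅ b≃c ◅◅ c≃c′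

·-cong-⟶* : ∀ {a a′ b b′} → a ⟶* a′ → b ⟶* b′ → (a · b) ⟶* (a′ · b′)
·-cong-⟶* {a′ = a′} {b = b} a⟶*a′ b⟶*b′ =
  Star.gmap (_· b) (λ { (n , s) → n , appL s }) a⟶*a′ ◅◅
  Star.gmap (a′ ·_) (λ { (n , s) → n , appR s }) b⟶*b′

infixl 8 _·ˢ_

_·ˢ_ : Term → List Term → Term
t ·ˢ []       = t
t ·ˢ (r ∷ rs) = (t · r) ·ˢ rs

Step-·ˢ : ∀ {n a b} rs → Step n a b → Step n (a ·ˢ rs) (b ·ˢ rs)
Step-·ˢ []       s = s
Step-·ˢ (r ∷ rs) s = Step-·ˢ rs (appL s)

⟶*-·ˢ : ∀ {a b} rs → a ⟶* b → (a ·ˢ rs) ⟶* (b ·ˢ rs)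
⟶*-·ˢ rs = Star.gmap (_·ˢ rs) (λ { (n , s) → n , Step-·ˢ rs s })

data Par : ℕ → Term → Term → Set where
  refl  : ∀ {m t} → Par m t t
  _·_   : ∀ {m a a′ b b′} → Par m a a′ → Par m b b′ → Par m (a · b) (a′ · b′)
  K-red : ∀ {m x x′ y} → Par m x x′ → Par m (K · x · y) x′
  S-red : ∀ {m x x′ y y′ z z′} → Par m x x′ → Par m y y′ → Par m z z′ →
          Par m (S · x · y · z) (x′ · z′ · (y′ · z′))
  CT-red : ∀ {m x x′ y} → Par m x x′ → Par m (C · T · x · y) x′
  CF-red : ∀ {m x y y′} → Par m y y′ → Par m (C · F · x · y) y′
  Cz-red : ∀ {k z x y} → Conv k x y → Par (suc k) (C · z · x · y) x

Step⇒Par : ∀ {m a b} → Step m a b → Par m a b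
Step⇒Par CT       = CT-red refl
Step⇒Par CF       = CF-red refl
Step⇒Par (Cz c)   = Cz-red c
Step⇒Par Kr       = K-red refl
Step⇒Par Sr       = S-red refl refl refl
Step⇒Par (appL s) = Step⇒Par s · refl
Step⇒Par (appR s) = refl · Step⇒Par s

Par⇒⟶* : ∀ {m a b} → Par m a b → a ⟶* b
Par⇒⟶* refl = ε
Par⇒⟶* (p · q) = ·-cong-⟶* (Par⇒⟶* p) (Par⇒⟶* q)
Par⇒⟶* {m} (K-red p) = (m , Kr) ◅ Par⇒⟶* p
Par⇒⟶* {m} (S-red p q r) =
  (m , Sr) ◅ ·-cong-⟶* (·-cong-⟶* (Par⇒⟶* p) (Par⇒⟶* r))
                       (·-cong-⟶* (Par⇒⟶* q) (Par⇒⟶* r))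
Par⇒⟶* {m} (CT-red p) = (m , CT) ◅ Par⇒⟶* p
Par⇒⟶* {m} (CF-red p) = (m , CF) ◅ Par⇒⟶* p
Par⇒⟶* (Cz-red {k} c) = (suc k , Cz c) ◅ ε

Par⇒≃ : ∀ {m a b} → Par m a b → a ≃ b
Par⇒≃ p = ⟶*⇒≃ (Par⇒⟶* p)

bool : Bool → Term
bool true  = T
bool false = F

infix 4 _◂_⇓_

data _◂_⇓_ : Term → List Term → Bool → Set where
  T⇓    : T ◂ [] ⇓ true
  F⇓    : F ◂ [] ⇓ false
  push  : ∀ {g t r rs} → t ◂ r ∷ rs ⇓ g → t · r ◂ rs ⇓ g
  K⇓    : ∀ {g x y rs} → x ◂ rs ⇓ g → K ◂ x ∷ y ∷ rs ⇓ g
  S⇓    : ∀ {g x y z rs} → x ◂ z ∷ y · z ∷ rs ⇓ g → S ◂ x ∷ y ∷ z ∷ rs ⇓ g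
  CT⇓   : ∀ {g a b c rs} → a ◂ [] ⇓ true → b ◂ rs ⇓ g → C ◂ a ∷ b ∷ c ∷ rs ⇓ g
  CF⇓   : ∀ {g a b c rs} → a ◂ [] ⇓ false → c ◂ rs ⇓ g → C ◂ a ∷ b ∷ c ∷ rs ⇓ g
  -- soundness ignores the derivation for c; it is needed once a reduces to F
  -- and the rule C F b c → c fires instead
  C≃⇓   : ∀ {g a b c rs} → b ≃ c → b ◂ rs ⇓ g → c ◂ rs ⇓ g →
          C ◂ a ∷ b ∷ c ∷ rs ⇓ g

⇓-sound : ∀ {g t rs} → t ◂ rs ⇓ g → (t ·ˢ rs) ⟶* bool g
⇓-sound T⇓ = ε
⇓-sound F⇓ = ε
⇓-sound (push d) = ⇓-sound d
⇓-sound {rs = _ ∷ _ ∷ rs} (K⇓ d) = (0 , Step-·ˢ rs Kr) ◅ ⇓-sound d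
⇓-sound {rs = _ ∷ _ ∷ _ ∷ rs} (S⇓ d) = (0 , Step-·ˢ rs Sr) ◅ ⇓-sound d
⇓-sound {rs = _ ∷ b ∷ c ∷ rs} (CT⇓ da db) =
  ⟶*-·ˢ (b ∷ c ∷ rs) (·-cong-⟶* ε (⇓-sound da)) ◅◅
  (0 , Step-·ˢ rs CT) ◅ ⇓-sound db
⇓-sound {rs = _ ∷ b ∷ c ∷ rs} (CF⇓ da dc) =
  ⟶*-·ˢ (b ∷ c ∷ rs) (·-cong-⟶* ε (⇓-sound da)) ◅◅
  (0 , Step-·ˢ rs CF) ◅ ⇓-sound dc
⇓-sound {rs = _ ∷ _ ∷ _ ∷ rs} (C≃⇓ b≃c db _) with ≃⇒Conv b≃c
... | N , b≈c = (suc N , Step-·ˢ rs (Cz b≈c)) ◅ ⇓-sound db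

Conv-closed : ℕ → Set
Conv-closed k = ∀ {g x y rs} → Conv k x y → y ◂ rs ⇓ g → x ◂ rs ⇓ g

data Conv-closed-below : ℕ → Set where
  zero : Conv-closed-below zero
  suc  : ∀ {k} → Conv-closed k → Conv-closed-below (suc k)

mutual
  Par-preserves-⇓ : ∀ {m g t t′ rs rs′} → Conv-closed-below m →
                    Par m t t′ → Pointwise (Par m) rs rs′ → t ◂ rs ⇓ g → t′ ◂ rs′ ⇓ g
  Par-preserves-⇓ cl refl ps d = Par-args-preserve-⇓ cl ps d
  Par-preserves-⇓ cl (p · q) ps (push d) = push (Par-preserves-⇓ cl p (q ∷ ps) d)
  Par-preserves-⇓ cl (K-red px) ps (push (push (K⇓ d))) = Par-preserves-⇓ cl px ps d
  Par-preserves-⇓ cl (S-red px py pz) ps (push (push (push (S⇓ d)))) =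
    push (push (Par-preserves-⇓ cl px (pz ∷ py · pz ∷ ps) d))
  Par-preserves-⇓ cl (CT-red px) ps (push (push (push (CT⇓ _ db)))) =
    Par-preserves-⇓ cl px ps db
  Par-preserves-⇓ cl (CT-red px) ps (push (push (push (CF⇓ () _))))
  Par-preserves-⇓ cl (CT-red px) ps (push (push (push (C≃⇓ _ db _)))) =
    Par-preserves-⇓ cl px ps db
  Par-preserves-⇓ cl (CF-red py) ps (push (push (push (CT⇓ () _))))
  Par-preserves-⇓ cl (CF-red py) ps (push (push (push (CF⇓ _ dc)))) =
    Par-preserves-⇓ cl py ps dc
  Par-preserves-⇓ cl (CF-red py) ps (push (push (push (C≃⇓ _ _ dc)))) =
    Par-preserves-⇓ cl py ps dc
  Par-preserves-⇓ cl (Cz-red _) ps (push (push (push (CT⇓ _ db)))) =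
    Par-args-preserve-⇓ cl ps db
  Par-preserves-⇓ cl (Cz-red _) ps (push (push (push (C≃⇓ _ db _)))) =
    Par-args-preserve-⇓ cl ps db
  -- Here the lower level is needed: C a x y with a evaluating to F may take the
  -- conditional step to x, while the derivation only says that y evaluates.
  Par-preserves-⇓ (suc cl) (Cz-red x≈y) ps (push (push (push (CF⇓ _ dc)))) =
    cl x≈y (Par-args-preserve-⇓ (suc cl) ps dc)

  Par-args-preserve-⇓ : ∀ {m g t rs rs′} → Conv-closed-below m →
                        Pointwise (Par m) rs rs′ → t ◂ rs ⇓ g → t ◂ rs′ ⇓ g
  Par-args-preserve-⇓ cl [] T⇓ = T⇓
  Par-args-preserve-⇓ cl [] F⇓ = F⇓
  Par-args-preserve-⇓ cl ps (push d) = push (Par-args-preserve-⇓ cl (refl ∷ ps) d)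
  Par-args-preserve-⇓ cl (px ∷ _ ∷ ps) (K⇓ d) = K⇓ (Par-preserves-⇓ cl px ps d)
  Par-args-preserve-⇓ cl (px ∷ py ∷ pz ∷ ps) (S⇓ d) =
    S⇓ (Par-preserves-⇓ cl px (pz ∷ py · pz ∷ ps) d)
  Par-args-preserve-⇓ cl (pa ∷ pb ∷ _ ∷ ps) (CT⇓ da db) =
    CT⇓ (Par-preserves-⇓ cl pa [] da) (Par-preserves-⇓ cl pb ps db)
  Par-args-preserve-⇓ cl (pa ∷ _ ∷ pc ∷ ps) (CF⇓ da dc) =
    CF⇓ (Par-preserves-⇓ cl pa [] da) (Par-preserves-⇓ cl pc ps dc)
  Par-args-preserve-⇓ cl (_ ∷ pb ∷ pc ∷ ps) (C≃⇓ b≃c db dc) =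
    C≃⇓ (≃-transport (Par⇒≃ pb) (Par⇒≃ pc) b≃c)
        (Par-preserves-⇓ cl pb ps db) (Par-preserves-⇓ cl pc ps dc)

mutual
  Par-reflects-⇓ : ∀ {m g s t rs rs′} → Conv-closed-below m →
                   Par m s t → Pointwise (Par m) rs rs′ → t ◂ rs′ ⇓ g → s ◂ rs ⇓ g
  Par-reflects-⇓ cl refl ps d = Par-args-reflect-⇓ cl ps d
  Par-reflects-⇓ cl (p · q) ps (push d) = push (Par-reflects-⇓ cl p (q ∷ ps) d)
  Par-reflects-⇓ cl (K-red px) ps d = push (push (K⇓ (Par-reflects-⇓ cl px ps d)))
  Par-reflects-⇓ cl (S-red px py pz) ps (push (push d)) =
    push (push (push (S⇓ (Par-reflects-⇓ cl px (pz ∷ py · pz ∷ ps) d))))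
  Par-reflects-⇓ cl (CT-red px) ps d =
    push (push (push (CT⇓ T⇓ (Par-reflects-⇓ cl px ps d))))
  Par-reflects-⇓ cl (CF-red py) ps d =
    push (push (push (CF⇓ F⇓ (Par-reflects-⇓ cl py ps d))))
  Par-reflects-⇓ (suc cl) (Cz-red x≈y) ps d =
    push (push (push (C≃⇓ (Conv⇒≃ x≈y) dx (cl (symmetric _ x≈y) dx))))
    where dx = Par-args-reflect-⇓ (suc cl) ps d

  Par-args-reflect-⇓ : ∀ {m g t rs rs′} → Conv-closed-below m →
                       Pointwise (Par m) rs rs′ → t ◂ rs′ ⇓ g → t ◂ rs ⇓ g
  Par-args-reflect-⇓ cl [] T⇓ = T⇓
  Par-args-reflect-⇓ cl [] F⇓ = F⇓
  Par-args-reflect-⇓ cl ps (push d) = push (Par-args-reflect-⇓ cl (refl ∷ ps) d)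
  Par-args-reflect-⇓ cl (px ∷ _ ∷ ps) (K⇓ d) = K⇓ (Par-reflects-⇓ cl px ps d)
  Par-args-reflect-⇓ cl (px ∷ py ∷ pz ∷ ps) (S⇓ d) =
    S⇓ (Par-reflects-⇓ cl px (pz ∷ py · pz ∷ ps) d)
  Par-args-reflect-⇓ cl (pa ∷ pb ∷ _ ∷ ps) (CT⇓ da db) =
    CT⇓ (Par-reflects-⇓ cl pa [] da) (Par-reflects-⇓ cl pb ps db)
  Par-args-reflect-⇓ cl (pa ∷ _ ∷ pc ∷ ps) (CF⇓ da dc) =
    CF⇓ (Par-reflects-⇓ cl pa [] da) (Par-reflects-⇓ cl pc ps dc)
  Par-args-reflect-⇓ cl (_ ∷ pb ∷ pc ∷ ps) (C≃⇓ b≃c db dc) =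
    C≃⇓ (≃-transport (symmetric _ (Par⇒≃ pb)) (symmetric _ (Par⇒≃ pc)) b≃c)
        (Par-reflects-⇓ cl pb ps db) (Par-reflects-⇓ cl pc ps dc)

mutual
  ⇓-Conv-closed : ∀ k → Conv-closed k
  ⇓-Conv-closed k ε d = d
  ⇓-Conv-closed k (fwd s ◅ ss) d =
    Par-reflects-⇓ (⇓-Conv-closed-below k) (Step⇒Par s) (Pointwise.refl refl)
                   (⇓-Conv-closed k ss d)
  ⇓-Conv-closed k (bwd s ◅ ss) d =
    Par-preserves-⇓ (⇓-Conv-closed-below k) (Step⇒Par s) (Pointwise.refl refl)
                    (⇓-Conv-closed k ss d)

  ⇓-Conv-closed-below : ∀ k → Conv-closed-below k
  ⇓-Conv-closed-below zero    = zero
  ⇓-Conv-closed-below (suc k) = suc (⇓-Conv-closed k)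

⇓-≃-closed : ∀ {g x y rs} → x ≃ y → y ◂ rs ⇓ g → x ◂ rs ⇓ g
⇓-≃-closed x≃y with ≃⇒Conv x≃y
... | N , x≈y = ⇓-Conv-closed N x≈y

mainTheorem4 : (q : Term) → q ≃ F → q ⟶* F
mainTheorem4 q q≃F = ⇓-sound (⇓-≃-closed q≃F F⇓)
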